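{- Let $R(x,y)=\sum_{P}x^{|P|/2}y^{peak(P)}$, the sum ranging over nonempty floating Dyck prefixes $P$ of even length, and let $\hat R(x,y)=\sum_{Q}x^{|Q|/2}y^{peak(Q)}$, the sum ranging over Dyck prefixes $Q$ of even length whose last step is an up step. Then $R(x,y)=\hat R(x,y)$.
   Context: A Dyck prefix is a lattice path from the origin with steps $U=(1,1)$, $D=(1,-1)$ never going below the $x$-axis (a word in $U,D$); $|P|$ denotes its length. A return is a down step ending on the $x$-axis; a floating Dyck prefix is a Dyck prefix with no return. $peak(P)$ is the number of occurrences of the factor $UD$ in $P$. -}

module Defs where

open import Data.Nat using (ℕ; zero; suc; _*_; _≡ᵇ_)
open import Data.Bool using (Bool; true; false; _∧_; not)
open import Data.List using (List; []; _∷_; length; filterᵇ; map; _++_)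

-- Steps U = (1,1), D = (1,-1); a path is a word in U, D.
data Step : Set where
  U D : Step

Word : Set
Word = List Step

words : ℕ → List Word
words zero = [] ∷ []
words (suc m) = map (U ∷_) (words m) ++ map (D ∷_) (words m)

staysNonneg : ℕ → Word → Bool
staysNonneg h [] = true
staysNonneg h (U ∷ w) = staysNonneg (suc h) w
staysNonneg zero (D ∷ w) = false
staysNonneg (suc h) (D ∷ w) = staysNonneg h w

isDyckPrefix : Word → Bool
isDyckPrefix = staysNonneg 0

hasReturnFrom : ℕ → Word → Bool
hasReturnFrom h [] = false
hasReturnFrom h (U ∷ w) = hasReturnFrom (suc h) w
hasReturnFrom zero (D ∷ w) = hasReturnFrom zero w
hasReturnFrom (suc zero) (D ∷ w) = true
hasReturnFrom (suc (suc h)) (D ∷ w) = hasReturnFrom (suc h) w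

hasReturn : Word → Bool
hasReturn = hasReturnFrom 0

isFloating : Word → Bool
isFloating w = isDyckPrefix w ∧ not (hasReturn w)

isNonempty : Word → Bool
isNonempty [] = false
isNonempty (_ ∷ _) = true

endsWithU : Word → Bool
endsWithU [] = false
endsWithU (U ∷ []) = true
endsWithU (D ∷ []) = false
endsWithU (_ ∷ s ∷ w) = endsWithU (s ∷ w)

peak : Word → ℕ
peak [] = 0
peak (U ∷ D ∷ w) = suc (peak (D ∷ w))
peak (_ ∷ w) = peak w

-- coefficient of x^n y^k in R(x,y): nonempty floating Dyck prefixes of length 2n with k peaks
coeffR : ℕ → ℕ → ℕ
coeffR n k = length (filterᵇ (λ P → isNonempty P ∧ isFloating P ∧ (peak P ≡ᵇ k)) (words (2 * n)))

-- coefficient of x^n y^k in R̂(x,y): Dyck prefixes of length 2n ending with U, with k peaks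
coeffR̂ : ℕ → ℕ → ℕ
coeffR̂ n k = length (filterᵇ (λ Q → isDyckPrefix Q ∧ endsWithU Q ∧ (peak Q ≡ᵇ k)) (words (2 * n)))

module Submission where

-- A nonempty floating
-- Dyck prefix must start with U, and  U·w  is floating exactly when  w  is a
-- Dyck prefix (a return of U·w is a visit of w below its starting level).
-- A Dyck prefix ending with U is  w·U  with  w  a Dyck prefix.  In both
-- cases the added U creates no new peak.  Hence, for every length m + 1 and
-- every k, both families are in bijection with the Dyck prefixes of length m
-- having k peaks; this holds for all lengths, not only even ones.

open import Defs
open import Data.Nat using (ℕ; zero; suc; _+_; _≡ᵇ_)
open import Data.Nat.Properties using (+-commutativeSemigroup)
open import Data.Bool using (Bool; true; false; _∧_; not)
open import Data.List using (List; []; _∷_; length; filterᵇ; map; _++_; _∷ʳ_)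
open import Data.List.Properties using (length-++; filter-++)
open import Algebra.Properties.CommutativeSemigroup +-commutativeSemigroup using (interchange)
open import Relation.Binary.PropositionalEquality
open import Relation.Nullary.Decidable using (T?)

count : (Word → Bool) → List Word → ℕ
count p ws = length (filterᵇ p ws)

count-++ : ∀ p xs ys → count p (xs ++ ys) ≡ count p xs + count p ys
count-++ p xs ys =
  trans (cong length (filter-++ (λ w → T? (p w)) xs ys)) (length-++ (filterᵇ p xs))

count-map : ∀ p (f : Word → Word) xs → count p (map f xs) ≡ count (λ w → p (f w)) xs
count-map p f [] = refl
count-map p f (x ∷ xs) with p (f x)
... | true = cong suc (count-map p f xs)
... | false = count-map p f xs

count-cong : ∀ {p q} xs → (∀ w → p w ≡ q w) → count p xs ≡ count q xs
count-cong [] p≗q = refl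
count-cong {p} {q} (x ∷ xs) p≗q with p x | q x | p≗q x
... | true | .true | refl = cong suc (count-cong xs p≗q)
... | false | .false | refl = count-cong xs p≗q

count-none : ∀ {p} xs → (∀ w → p w ≡ false) → count p xs ≡ 0
count-none [] p≗false = refl
count-none (x ∷ xs) p≗false rewrite p≗false x = count-none xs p≗false

count-two-images : ∀ p (f g : Word → Word) xs →
  count p (map f xs ++ map g xs) ≡ count (λ w → p (f w)) xs + count (λ w → p (g w)) xs
count-two-images p f g xs =
  trans (count-++ p (map f xs) (map g xs)) (cong₂ _+_ (count-map p f xs) (count-map p g xs))

#words : (Word → Bool) → ℕ → ℕ
#words p m = count p (words m)

#words-first : ∀ p m →
  #words p (suc m) ≡ #words (λ w → p (U ∷ w)) m + #words (λ w → p (D ∷ w)) m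
#words-first p m = count-two-images p (U ∷_) (D ∷_) (words m)

#words-last : ∀ p m →
  #words p (suc m) ≡ #words (λ w → p (w ∷ʳ U)) m + #words (λ w → p (w ∷ʳ D)) m
#words-last p zero = count-two-images p (_∷ʳ U) (_∷ʳ D) (words 0)
#words-last p (suc m) = begin
    #words p (suc (suc m))
  ≡⟨ #words-first p (suc m) ⟩
    #words (λ w → p (U ∷ w)) (suc m) + #words (λ w → p (D ∷ w)) (suc m)
  ≡⟨ cong₂ _+_ (#words-last (λ w → p (U ∷ w)) m) (#words-last (λ w → p (D ∷ w)) m) ⟩
    (#words (λ w → p (U ∷ w ∷ʳ U)) m + #words (λ w → p (U ∷ w ∷ʳ D)) m)
      + (#words (λ w → p (D ∷ w ∷ʳ U)) m + #words (λ w → p (D ∷ w ∷ʳ D)) m)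
  ≡⟨ interchange (#words (λ w → p (U ∷ w ∷ʳ U)) m) (#words (λ w → p (U ∷ w ∷ʳ D)) m)
                 (#words (λ w → p (D ∷ w ∷ʳ U)) m) (#words (λ w → p (D ∷ w ∷ʳ D)) m) ⟩
    (#words (λ w → p (U ∷ w ∷ʳ U)) m + #words (λ w → p (D ∷ w ∷ʳ U)) m)
      + (#words (λ w → p (U ∷ w ∷ʳ D)) m + #words (λ w → p (D ∷ w ∷ʳ D)) m)
  ≡⟨ sym (cong₂ _+_ (#words-first (λ w → p (w ∷ʳ U)) m) (#words-first (λ w → p (w ∷ʳ D)) m)) ⟩
    #words (λ w → p (w ∷ʳ U)) (suc m) + #words (λ w → p (w ∷ʳ D)) (suc m)
  ∎
  where open ≡-Reasoning

-- Started at height h + 1, staying nonnegative without a return means never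
-- going below height 1, i.e. the path shifted down by one stays nonnegative.
floating⇔shiftedNonneg : ∀ h w →
  (staysNonneg (suc h) w ∧ not (hasReturnFrom (suc h) w)) ≡ staysNonneg h w
floating⇔shiftedNonneg h [] = refl
floating⇔shiftedNonneg h (U ∷ w) = floating⇔shiftedNonneg (suc h) w
floating⇔shiftedNonneg zero (D ∷ w) with staysNonneg zero w
... | true = refl
... | false = refl
floating⇔shiftedNonneg (suc h) (D ∷ w) = floating⇔shiftedNonneg h w

staysNonneg-∷ʳU : ∀ h w → staysNonneg h (w ∷ʳ U) ≡ staysNonneg h w
staysNonneg-∷ʳU h [] = refl
staysNonneg-∷ʳU h (U ∷ w) = staysNonneg-∷ʳU (suc h) w
staysNonneg-∷ʳU zero (D ∷ w) = refl
staysNonneg-∷ʳU (suc h) (D ∷ w) = staysNonneg-∷ʳU h w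

isU : Step → Bool
isU U = true
isU D = false

endsWithU-∷ʳ : ∀ w s → endsWithU (w ∷ʳ s) ≡ isU s
endsWithU-∷ʳ [] U = refl
endsWithU-∷ʳ [] D = refl
endsWithU-∷ʳ (U ∷ []) U = refl
endsWithU-∷ʳ (U ∷ []) D = refl
endsWithU-∷ʳ (D ∷ []) U = refl
endsWithU-∷ʳ (D ∷ []) D = refl
endsWithU-∷ʳ (U ∷ t ∷ w) s = endsWithU-∷ʳ (t ∷ w) s
endsWithU-∷ʳ (D ∷ t ∷ w) s = endsWithU-∷ʳ (t ∷ w) s

peak-∷ʳU : ∀ w → peak (w ∷ʳ U) ≡ peak w
peak-∷ʳU [] = refl
peak-∷ʳU (U ∷ []) = refl
peak-∷ʳU (U ∷ D ∷ w) = cong suc (peak-∷ʳU (D ∷ w))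
peak-∷ʳU (U ∷ U ∷ w) = peak-∷ʳU (U ∷ w)
peak-∷ʳU (D ∷ w) = peak-∷ʳU w

-- An initial up step creates no peak on a Dyck prefix (which cannot start with D).
peak-U∷-DyckPrefix : ∀ k w →
  (isDyckPrefix w ∧ (peak (U ∷ w) ≡ᵇ k)) ≡ (isDyckPrefix w ∧ (peak w ≡ᵇ k))
peak-U∷-DyckPrefix k [] = refl
peak-U∷-DyckPrefix k (U ∷ w) = refl
peak-U∷-DyckPrefix k (D ∷ w) = refl

inR : ℕ → Word → Bool
inR k P = isNonempty P ∧ isFloating P ∧ (peak P ≡ᵇ k)

inR̂ : ℕ → Word → Bool
inR̂ k Q = isDyckPrefix Q ∧ endsWithU Q ∧ (peak Q ≡ᵇ k)

dyckWithPeaks : ℕ → Word → Bool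
dyckWithPeaks k w = isDyckPrefix w ∧ (peak w ≡ᵇ k)

inR-U∷ : ∀ k w → inR k (U ∷ w) ≡ dyckWithPeaks k w
inR-U∷ k w = trans (cong (_∧ (peak (U ∷ w) ≡ᵇ k)) (floating⇔shiftedNonneg 0 w))
                   (peak-U∷-DyckPrefix k w)

inR-D∷ : ∀ k w → inR k (D ∷ w) ≡ false
inR-D∷ k w = refl

inR̂-∷ʳU : ∀ k w → inR̂ k (w ∷ʳ U) ≡ dyckWithPeaks k w
inR̂-∷ʳU k w rewrite staysNonneg-∷ʳU 0 w | endsWithU-∷ʳ w U | peak-∷ʳU w = refl

inR̂-∷ʳD : ∀ k w → inR̂ k (w ∷ʳ D) ≡ false
inR̂-∷ʳD k w rewrite endsWithU-∷ʳ w D with isDyckPrefix (w ∷ʳ D)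
... | true = refl
... | false = refl

#inR≡#inR̂ : ∀ k m → #words (inR k) (suc m) ≡ #words (inR̂ k) (suc m)
#inR≡#inR̂ k m = begin
    #words (inR k) (suc m)
  ≡⟨ #words-first (inR k) m ⟩
    #words (λ w → inR k (U ∷ w)) m + #words (λ w → inR k (D ∷ w)) m
  ≡⟨ cong₂ _+_ (count-cong (words m) (inR-U∷ k)) (count-none (words m) (inR-D∷ k)) ⟩
    #words (dyckWithPeaks k) m + 0
  ≡⟨ sym (cong₂ _+_ (count-cong (words m) (inR̂-∷ʳU k)) (count-none (words m) (inR̂-∷ʳD k))) ⟩
    #words (λ w → inR̂ k (w ∷ʳ U)) m + #words (λ w → inR̂ k (w ∷ʳ D)) m
  ≡⟨ sym (#words-last (inR̂ k) m) ⟩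
    #words (inR̂ k) (suc m)
  ∎
  where open ≡-Reasoning

-- Coefficientwise R = R̂: the constant terms are both 0 (no empty word is
-- counted), and every other coefficient counts words of length
-- 2 * (n + 1) = (n + (n + 1)) + 1.
proposition19 : (n k : ℕ) → coeffR n k ≡ coeffR̂ n k
proposition19 zero k = refl
proposition19 (suc n) k = #inR≡#inR̂ k (n + suc (n + 0))
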